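{- Let $a\in\mathbb{N}$ with $a\geq 3$, and let $S(a)$ be the submonoid of $(\mathbb{N},+)$ generated by $\{f_a+f_n \mid n\in\mathbb{N}\}$. Write $\mathrm{Ap}(S(a),f_a)=\{w(0)=0,w(1),\ldots,w(f_a-1)\}$, where $w(i)$ is the least element of $S(a)$ congruent to $i$ modulo $f_a$. Then for every $x\in\{0,1,\ldots,f_a-1\}$ we have $w(x)=\beta(x)f_a+x$.
   Context: $\{f_n\}_{n\in\mathbb{N}}$ is the Fibonacci sequence: $f_0=0$, $f_1=1$, $f_{n+2}=f_{n+1}+f_n$. $S(a)$ is a numerical semigroup (a submonoid of $\mathbb{N}$ with finite complement). For a numerical semigroup $S$ and $n\in S\setminus\{0\}$, the Apéry set is $\mathrm{Ap}(S,n)=\{s\in S\mid s-n\notin S\}$. For $x\in\mathbb{N}$, $\beta(x)=\min\{\sum_{i=2}^{l} b_i \mid x=\sum_{i=2}^{l} b_i f_i,\ (b_2,\ldots,b_l)\in\mathbb{N}^{l-1},\ l\geq 2\}$ (so $\beta(0)=0$). -}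

module Defs where

open import Data.Nat using (ℕ; zero; suc; _+_; _*_; _≤_)
open import Data.List using (List; []; _∷_)
open import Data.Nat.ListAction using (sum)
open import Data.Product using (Σ; _×_; ∃)
open import Relation.Binary.PropositionalEquality using (_≡_)

fib : ℕ → ℕ
fib zero = 0
fib (suc zero) = 1
fib (suc (suc n)) = fib (suc n) + fib n

data InS (a : ℕ) : ℕ → Set where
  s-zero : InS a 0
  s-add  : ∀ {s} → InS a s → (n : ℕ) → InS a (s + (fib a + fib n))

fibVal : List ℕ → ℕ → ℕ
fibVal [] i = 0
fibVal (b ∷ bs) i = b * fib i + fibVal bs (suc i)

-- x = Σ_{i=2}^{l} b_i f_i with Σ b_i = c, coefficients listed as (b_2, …, b_l)
FibRep : ℕ → ℕ → Set
FibRep x c = Σ (List ℕ) λ bs → (fibVal bs 2 ≡ x) × (sum bs ≡ c)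

IsBeta : ℕ → ℕ → Set
IsBeta x c = FibRep x c × (∀ c' → FibRep x c' → c ≤ c')

CongMod : ℕ → ℕ → ℕ → Set
CongMod m s x = ∃ λ k → s ≡ k * m + x

IsLeastInClass : ℕ → ℕ → ℕ → Set
IsLeastInClass a x w =
  InS a w × CongMod (fib a) w x × (∀ s → InS a s → CongMod (fib a) s x → w ≤ s)

-- A multiset of Fibonacci numbers below f_m with sum ≥ f_m can be rewritten as
-- f_m plus strictly fewer of them (carrying).  Hence the greedy choice of the
-- largest Fibonacci summand computes β.  An element of S(a) is t·f_a plus at
-- most t numbers f_i (i ≥ 2); carrying their sum modulo f_a, and using that
-- every f_n with n ≥ a is q·f_a plus at most q smaller ones, leaves its residue
-- x as a sum of at most k Fibonacci numbers when the element is k·f_a + x.  So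
-- k ≥ β(x), while β(x)·f_a + x is itself a sum of β(x) generators f_a + f_i.
module Submission where

open import Defs
open import Data.Nat using (ℕ; zero; suc; pred; _+_; _*_; _∸_; _≤_; _<_; z≤n; s≤s; NonZero; >-nonZero; _≟_; _<?_)
open import Data.Nat.Properties
open import Algebra.Properties.CommutativeSemigroup +-commutativeSemigroup
  using (interchange; x∙yz≈y∙xz; x∙yz≈z∙xy)
open import Data.Nat.DivMod using (_%_; %-congˡ; [m+kn]%n≡m%n; m<n⇒m%n≡m)
open import Data.Nat.Induction using (<-rec)
open import Data.Nat.ListAction using (sum)
open import Data.Nat.ListAction.Properties using (sum-++)
open import Data.Nat.Tactic.RingSolver using (solve-∀)
open import Data.List using (List; []; _∷_; length; map; _++_; replicate)
open import Data.List.Properties using (length-++; length-replicate; length-removeAt′; map-++)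
open import Data.List.Relation.Unary.All as All using (All; []; _∷_)
open import Data.List.Relation.Unary.All.Properties using (++⁺; ─⁺)
open import Data.List.Relation.Unary.Any using (here; there; _─_)
open import Data.List.Membership.Propositional using (_∈_; _∉_)
open import Data.List.Membership.DecPropositional _≟_ using (_∈?_)
open import Data.Product using (Σ; Σ-syntax; _×_; _,_; proj₁)
open import Data.Sum using (inj₁; inj₂)
open import Function using (_∘_)
open import Relation.Nullary using (yes; no)
open import Relation.Binary.PropositionalEquality
open ≡-Reasoning

-- Index k stands for f_{k+2}: a list of indices is a multiset of Fibonacci
-- numbers f_i with i ≥ 2, and its length is the coefficient sum counted by β.
F : ℕ → ℕ
F k = fib (suc (suc k))

fibSum : List ℕ → ℕ
fibSum L = sum (map F L)

fibSum-++ : ∀ L M → fibSum (L ++ M) ≡ fibSum L + fibSum M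
fibSum-++ L M = trans (cong sum (map-++ F L M)) (sum-++ (map F L) (map F M))

1≤fib-suc : ∀ k → 1 ≤ fib (suc k)
1≤fib-suc zero = ≤-refl
1≤fib-suc (suc k) = ≤-trans (1≤fib-suc k) (m≤m+n (fib (suc k)) (fib k))

F-<-suc : ∀ k → F k < F (suc k)
F-<-suc k = m<m+n (F k) (1≤fib-suc k)

-- F 1 = 2 = F 0 + F 0, so the recurrence extends to n = 0 with pred.
F-suc : ∀ n → F (suc n) ≡ F n + F (pred n)
F-suc zero = refl
F-suc (suc n) = refl

F-mono-< : ∀ {j k} → j < k → F j < F k
F-mono-< {j} {suc k} j<1+k with m≤n⇒m<n∨m≡n (≤-pred j<1+k)
... | inj₁ j<k = <-trans (F-mono-< j<k) (F-<-suc k)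
... | inj₂ refl = F-<-suc k

F-mono-≤ : ∀ {j k} → j ≤ k → F j ≤ F k
F-mono-≤ j≤k with m≤n⇒m<n∨m≡n j≤k
... | inj₁ j<k = <⇒≤ (F-mono-< j<k)
... | inj₂ refl = ≤-refl

F-cancel-< : ∀ {j k} → F j < F k → j < k
F-cancel-< Fj<Fk = ≰⇒> (λ k≤j → <⇒≱ Fj<Fk (F-mono-≤ k≤j))

fibSum<F⇒All< : ∀ {b} L → fibSum L < F b → All (_< b) L
fibSum<F⇒All< [] _ = []
fibSum<F⇒All< (k ∷ L) lt =
  F-cancel-< (≤-<-trans (m≤m+n (F k) (fibSum L)) lt) ∷
  fibSum<F⇒All< L (≤-<-trans (m≤n+m (fibSum L) (F k)) lt)

F-bracket : ∀ x → 0 < x → Σ[ i ∈ ℕ ] F i ≤ x × x < F (suc i)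
F-bracket (suc zero) _ = 0 , ≤-refl , s≤s (s≤s z≤n)
F-bracket (suc (suc x)) _ with F-bracket (suc x) (s≤s z≤n)
... | i , Fi≤x , x<Fi+1 with suc (suc x) <? F (suc i)
...   | yes lt = i , m≤n⇒m≤1+n Fi≤x , lt
...   | no ≮ = suc i , ≤-reflexive (sym x+2≡) , subst (_< F (suc (suc i))) (sym x+2≡) (F-<-suc (suc i))
  where
  x+2≡ : suc (suc x) ≡ F (suc i)
  x+2≡ = ≤-antisym x<Fi+1 (≮⇒≥ ≮)

record Split (_≺_ : ℕ → ℕ → Set) (b m : ℕ) (L : List ℕ) : Set where
  constructor split
  field
    rest    : List ℕ
    bounded : All (_< b) rest
    sum-eq  : fibSum rest + F m ≡ fibSum L
    shorter : length rest ≺ length L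

Split-widen : ∀ {_≺_ b b′ m L} → b ≤ b′ → Split _≺_ b m L → Split _≺_ b′ m L
Split-widen b≤b′ (split L′ bnd eq len) = split L′ (All.map (λ i<b → <-≤-trans i<b b≤b′) bnd) eq len

Split-≤ : ∀ {b m L} → Split _<_ b m L → Split _≤_ b m L
Split-≤ (split L′ bnd eq len) = split L′ bnd eq (<⇒≤ len)

fibSum-─ : ∀ {k L} (p : k ∈ L) → fibSum L ≡ F k + fibSum (L ─ p)
fibSum-─ (here refl) = refl
fibSum-─ {k} {j ∷ L} (there p) = begin
  F j + fibSum L              ≡⟨ cong (F j +_) (fibSum-─ p) ⟩
  F j + (F k + fibSum (L ─ p)) ≡⟨ x∙yz≈y∙xz (F j) (F k) _ ⟩
  F k + (F j + fibSum (L ─ p)) ∎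

remove : ∀ {b k L} → All (_< b) L → (p : k ∈ L) → Split _<_ b k L
remove {L = L} bnd p =
  split (L ─ p) (─⁺ p bnd) (trans (+-comm (fibSum (L ─ p)) _) (sym (fibSum-─ p))) (≤-reflexive (sym (length-removeAt′ L _)))

bounded-∉ : ∀ {k L} → All (_< suc k) L → k ∉ L → All (_< k) L
bounded-∉ [] _ = []
bounded-∉ (j<1+k ∷ js) k∉L = ≤∧≢⇒< (≤-pred j<1+k) (k∉L ∘ here ∘ sym) ∷ bounded-∉ js (k∉L ∘ there)

chain : ∀ {b i j m L} → F m ≡ F i + F j →
        (s : Split _<_ b i L) → Split _≤_ b j (Split.rest s) → Split _<_ b m L
chain {i = i} {j} {m} {L} Fm≡ (split L₁ _ e₁ l₁) (split L₂ bnd₂ e₂ l₂) =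
  split L₂ bnd₂ sum-eq (≤-<-trans l₂ l₁)
  where
  sum-eq : fibSum L₂ + F m ≡ fibSum L
  sum-eq = begin
    fibSum L₂ + F m         ≡⟨ cong (fibSum L₂ +_) (trans Fm≡ (+-comm (F i) (F j))) ⟩
    fibSum L₂ + (F j + F i) ≡⟨ sym (+-assoc (fibSum L₂) (F j) (F i)) ⟩
    fibSum L₂ + F j + F i   ≡⟨ cong (_+ F i) e₂ ⟩
    fibSum L₁ + F i         ≡⟨ e₁ ⟩
    fibSum L                ∎

rest-≥ : ∀ {_≺_ b i j L} (s : Split _≺_ b i L) → F i + F j ≤ fibSum L → F j ≤ fibSum (Split.rest s)
rest-≥ {i = i} {j} (split L₁ _ e₁ _) h =
  +-cancelˡ-≤ (F i) (F j) (fibSum L₁) (subst (F i + F j ≤_) (trans (sym e₁) (+-comm (fibSum L₁) (F i))) h)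

trade : ∀ {b n L} → pred n < b → Split _<_ b (suc n) L → Split _≤_ b n L
trade {n = n} {L} n-1<b (split L₀ bnd e l) = split (pred n ∷ L₀) (n-1<b ∷ bnd) sum-eq l
  where
  sum-eq : F (pred n) + fibSum L₀ + F n ≡ fibSum L
  sum-eq = begin
    F (pred n) + fibSum L₀ + F n   ≡⟨ cong (_+ F n) (+-comm (F (pred n)) (fibSum L₀)) ⟩
    fibSum L₀ + F (pred n) + F n   ≡⟨ +-assoc (fibSum L₀) (F (pred n)) (F n) ⟩
    fibSum L₀ + (F (pred n) + F n) ≡⟨ cong (fibSum L₀ +_) (trans (+-comm (F (pred n)) (F n)) (sym (F-suc n))) ⟩
    fibSum L₀ + F (suc n)          ≡⟨ e ⟩
    fibSum L                       ∎

-- Carrying: F m = F (m-1) + F (m-2), so first split off F (m-1) (removing it if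
-- present, else carrying below it), then F (m-2) from the rest, where an
-- occurrence of F (m-1) may be traded for F (m-2) + F (m-3) at no cost.
mutual
  carry : ∀ m L → All (_< m) L → F m ≤ fibSum L → Split _<_ m m L
  carry zero [] [] ()
  carry zero (_ ∷ _) (() ∷ _) _
  carry (suc zero) L bnd h =
    let first = splitOff 0 L bnd (≤-trans (m≤m+n (F 0) (F 0)) h)
        open Split first
    in  chain refl first (Split-≤ (splitOff 0 rest bounded (rest-≥ {j = 0} first h)))
  carry (suc (suc n)) L bnd h =
    let first = splitOff (suc n) L bnd (≤-trans (m≤m+n (F (suc n)) (F n)) h)
        open Split first
    in  chain refl first (splitOff-below n rest bounded (rest-≥ {j = n} first h))

  splitOff : ∀ m L → All (_< suc m) L → F m ≤ fibSum L → Split _<_ (suc m) m L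
  splitOff m L bnd h with m ∈? L
  ... | yes m∈L = remove bnd m∈L
  ... | no m∉L = Split-widen (n≤1+n m) (carry m L (bounded-∉ bnd m∉L) h)

  splitOff-below : ∀ n L → All (_< suc (suc n)) L → F n ≤ fibSum L → Split _≤_ (suc (suc n)) n L
  splitOff-below n L bnd h with suc n ∈? L
  ... | yes n+1∈L = trade (s≤s (m≤n⇒m≤1+n pred[n]≤n)) (remove bnd n+1∈L)
  ... | no n+1∉L = Split-≤ (Split-widen (n≤1+n (suc n)) (splitOff n L (bounded-∉ bnd n+1∉L) h))

record Optimal (x : ℕ) : Set where
  field
    summands : List ℕ
    value    : fibSum summands ≡ x
    minimal  : ∀ M → fibSum M ≡ x → length summands ≤ length M

-- Greedy choice of the largest summand F i ≤ x is optimal: any representation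
-- of x only uses indices ≤ i and can be rewritten to contain F i without growing.
optimal : ∀ x → Optimal x
optimal = <-rec Optimal greedy
  where
  greedy : ∀ x → (∀ {y} → y < x → Optimal y) → Optimal x
  greedy zero _ = record { summands = [] ; value = refl ; minimal = λ _ _ → z≤n }
  greedy (suc x) rec with F-bracket (suc x) (s≤s z≤n)
  ... | i , Fi≤x , x<Fi+1 = record
    { summands = i ∷ summands
    ; value    = trans (cong (F i +_) value) (m+[n∸m]≡n Fi≤x)
    ; minimal  = minimal′
    }
    where
    open Optimal (rec (∸-monoʳ-< {o = 0} (1≤fib-suc (suc i)) Fi≤x))
    minimal′ : ∀ M → fibSum M ≡ suc x → suc (length summands) ≤ length M
    minimal′ M M≡x with splitOff i M (fibSum<F⇒All< M (subst (_< F (suc i)) (sym M≡x) x<Fi+1))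
                                     (subst (F i ≤_) (sym M≡x) Fi≤x)
    ... | split M′ _ e l = ≤-<-trans (minimal M′ M′≡) l
      where
      M′≡ : fibSum M′ ≡ suc x ∸ F i
      M′≡ = trans (sym (m+n∸n≡m (fibSum M′) (F i))) (cong (_∸ F i) (trans e M≡x))

basis : ℕ → List ℕ
basis zero = 1 ∷ []
basis (suc k) = 0 ∷ basis k

fibVal-basis : ∀ k i → fibVal (basis k) i ≡ fib (k + i)
fibVal-basis zero i = trans (+-identityʳ (1 * fib i)) (*-identityˡ (fib i))
fibVal-basis (suc k) i = trans (fibVal-basis k (suc i)) (cong fib (+-suc k i))

sum-basis : ∀ k → sum (basis k) ≡ 1
sum-basis zero = refl
sum-basis (suc k) = sum-basis k

infixl 6 _⊕_
_⊕_ : List ℕ → List ℕ → List ℕ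
[] ⊕ ys = ys
(x ∷ xs) ⊕ [] = x ∷ xs
(x ∷ xs) ⊕ (y ∷ ys) = x + y ∷ xs ⊕ ys

fibVal-⊕ : ∀ xs ys i → fibVal (xs ⊕ ys) i ≡ fibVal xs i + fibVal ys i
fibVal-⊕ [] ys i = refl
fibVal-⊕ (x ∷ xs) [] i = sym (+-identityʳ _)
fibVal-⊕ (x ∷ xs) (y ∷ ys) i = begin
  (x + y) * fib i + fibVal (xs ⊕ ys) (suc i)
    ≡⟨ cong₂ _+_ (*-distribʳ-+ (fib i) x y) (fibVal-⊕ xs ys (suc i)) ⟩
  (x * fib i + y * fib i) + (fibVal xs (suc i) + fibVal ys (suc i))
    ≡⟨ interchange (x * fib i) (y * fib i) (fibVal xs (suc i)) (fibVal ys (suc i)) ⟩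
  (x * fib i + fibVal xs (suc i)) + (y * fib i + fibVal ys (suc i))
    ∎

sum-⊕ : ∀ xs ys → sum (xs ⊕ ys) ≡ sum xs + sum ys
sum-⊕ [] ys = refl
sum-⊕ (x ∷ xs) [] = sym (+-identityʳ _)
sum-⊕ (x ∷ xs) (y ∷ ys) = trans (cong (x + y +_) (sum-⊕ xs ys)) (interchange x y (sum xs) (sum ys))

coefficients : List ℕ → List ℕ
coefficients [] = []
coefficients (k ∷ L) = basis k ⊕ coefficients L

fibVal-coefficients : ∀ L → fibVal (coefficients L) 2 ≡ fibSum L
fibVal-coefficients [] = refl
fibVal-coefficients (k ∷ L) = trans (fibVal-⊕ (basis k) (coefficients L) 2)
  (cong₂ _+_ (trans (fibVal-basis k 2) (cong fib (+-comm k 2))) (fibVal-coefficients L))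

sum-coefficients : ∀ L → sum (coefficients L) ≡ length L
sum-coefficients [] = refl
sum-coefficients (k ∷ L) = trans (sum-⊕ (basis k) (coefficients L)) (cong₂ _+_ (sum-basis k) (sum-coefficients L))

fromCoefficients : List ℕ → ℕ → List ℕ
fromCoefficients [] i = []
fromCoefficients (b ∷ bs) i = replicate b i ++ fromCoefficients bs (suc i)

fibSum-replicate : ∀ b i → fibSum (replicate b i) ≡ b * F i
fibSum-replicate zero i = refl
fibSum-replicate (suc b) i = cong (F i +_) (fibSum-replicate b i)

fibSum-fromCoefficients : ∀ bs i → fibSum (fromCoefficients bs i) ≡ fibVal bs (suc (suc i))
fibSum-fromCoefficients [] i = refl
fibSum-fromCoefficients (b ∷ bs) i = trans (fibSum-++ (replicate b i) (fromCoefficients bs (suc i)))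
  (cong₂ _+_ (fibSum-replicate b i) (fibSum-fromCoefficients bs (suc i)))

length-fromCoefficients : ∀ bs i → length (fromCoefficients bs i) ≡ sum bs
length-fromCoefficients [] i = refl
length-fromCoefficients (b ∷ bs) i = trans (length-++ (replicate b i))
  (cong₂ _+_ (length-replicate b) (length-fromCoefficients bs (suc i)))

optimal⇒IsBeta : ∀ {x} (o : Optimal x) → IsBeta x (length (Optimal.summands o))
optimal⇒IsBeta {x} o =
  (coefficients summands , trans (fibVal-coefficients summands) value , sum-coefficients summands) ,
  λ { c (bs , bs≡x , sum≡c) → subst (length summands ≤_) (trans (length-fromCoefficients bs 0) sum≡c)
                                 (minimal (fromCoefficients bs 0) (trans (fibSum-fromCoefficients bs 0) bs≡x)) }
  where open Optimal o

record Reduction (m c y : ℕ) : Set where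
  constructor reduction
  field
    quot  : ℕ
    rem   : List ℕ
    rem<  : fibSum rem < F m
    y≡    : y ≡ quot * F m + fibSum rem
    short : length rem ≤ c + quot

Reduction-≤ : ∀ {m c c′ y} → c ≤ c′ → Reduction m c y → Reduction m c′ y
Reduction-≤ c≤c′ (reduction q r r< y≡ l) = reduction q r r< y≡ (≤-trans l (+-monoˡ-≤ q c≤c′))

normalise : ∀ {m c y q} L → All (_< m) L → fibSum L < F m + F m →
            y ≡ q * F m + fibSum L → length L ≤ c + q → Reduction m c y
normalise {m} {c} {y} {q} L bnd L<2F y≡ len with fibSum L <? F m
... | yes L<F = reduction q L L<F y≡ len
... | no L≮F with carry m L bnd (≮⇒≥ L≮F)
...   | split L′ _ e l = reduction (suc q) L′ L′<F y≡′ (≤-trans (<⇒≤ l) (≤-trans len (+-monoʳ-≤ c (n≤1+n q))))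
  where
  L′<F : fibSum L′ < F m
  L′<F = +-cancelʳ-< (F m) (fibSum L′) (F m) (subst (_< F m + F m) (sym e) L<2F)
  y≡′ : y ≡ suc q * F m + fibSum L′
  y≡′ = begin
    y                             ≡⟨ y≡ ⟩
    q * F m + fibSum L            ≡⟨ cong (q * F m +_) (sym e) ⟩
    q * F m + (fibSum L′ + F m)   ≡⟨ x∙yz≈z∙xy (q * F m) (fibSum L′) (F m) ⟩
    F m + (q * F m + fibSum L′)   ≡⟨ sym (+-assoc (F m) (q * F m) (fibSum L′)) ⟩
    suc q * F m + fibSum L′       ∎

reduction-+ : ∀ {m c₁ c₂ y₁ y₂} → Reduction m c₁ y₁ → Reduction m c₂ y₂ → Reduction m (c₁ + c₂) (y₁ + y₂)
reduction-+ {m} {c₁} {c₂} {y₁} {y₂} (reduction q₁ r₁ r₁< y₁≡ l₁) (reduction q₂ r₂ r₂< y₂≡ l₂) =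
  normalise (r₁ ++ r₂) (++⁺ (fibSum<F⇒All< r₁ r₁<) (fibSum<F⇒All< r₂ r₂<))
    (subst (_< F m + F m) (sym (fibSum-++ r₁ r₂)) (+-mono-< r₁< r₂<)) y≡ len
  where
  y≡ : y₁ + y₂ ≡ (q₁ + q₂) * F m + fibSum (r₁ ++ r₂)
  y≡ = begin
    y₁ + y₂
      ≡⟨ cong₂ _+_ y₁≡ y₂≡ ⟩
    (q₁ * F m + fibSum r₁) + (q₂ * F m + fibSum r₂)
      ≡⟨ interchange (q₁ * F m) (fibSum r₁) (q₂ * F m) (fibSum r₂) ⟩
    (q₁ * F m + q₂ * F m) + (fibSum r₁ + fibSum r₂)
      ≡⟨ cong₂ _+_ (sym (*-distribʳ-+ (F m) q₁ q₂)) (sym (fibSum-++ r₁ r₂)) ⟩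
    (q₁ + q₂) * F m + fibSum (r₁ ++ r₂)
      ∎
  len : length (r₁ ++ r₂) ≤ (c₁ + c₂) + (q₁ + q₂)
  len = ≤-trans (≤-reflexive (length-++ r₁))
          (≤-trans (+-mono-≤ l₁ l₂) (≤-reflexive (interchange c₁ q₁ c₂ q₂)))

reduction-F-< : ∀ {m k} → k < m → Reduction m 1 (F k)
reduction-F-< {m} {k} k<m =
  reduction 0 (k ∷ []) (subst (_< F m) (sym (+-identityʳ (F k))) (F-mono-< k<m)) (sym (+-identityʳ (F k))) ≤-refl

reduction-F-≥ : ∀ a j → Reduction (suc a) 0 (F (j + suc a)) × Reduction (suc a) 0 (F (suc j + suc a))
reduction-F-≥ a zero =
  reduction 1 [] (1≤fib-suc (suc (suc a))) (sym (trans (+-identityʳ (1 * F (suc a))) (*-identityˡ (F (suc a))))) z≤n ,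
  reduction 1 (a ∷ []) (subst (_< F (suc a)) (sym (+-identityʳ (F a))) (F-<-suc a))
    (sym (cong₂ _+_ (*-identityˡ (F (suc a))) (+-identityʳ (F a)))) ≤-refl
reduction-F-≥ a (suc j) with reduction-F-≥ a j
... | r , r′ = r′ , reduction-+ r′ r

reduction-F : ∀ a k → Reduction (suc a) 1 (F k)
reduction-F a k with k <? suc a
... | yes k<m = reduction-F-< k<m
... | no k≮m = Reduction-≤ z≤n (subst (Reduction (suc a) 0 ∘ F) (m∸n+n≡m (≮⇒≥ k≮m))
                                      (proj₁ (reduction-F-≥ a (k ∸ suc a))))

reduction-fibSum : ∀ a M → Reduction (suc a) (length M) (fibSum M)
reduction-fibSum a [] = reduction 0 [] (1≤fib-suc (suc (suc a))) refl z≤n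
reduction-fibSum a (k ∷ M) = reduction-+ (reduction-F a k) (reduction-fibSum a M)

quotRem-unique : ∀ {n q k r x} → r < n → x < n → q * n + r ≡ k * n + x → q ≡ k × r ≡ x
quotRem-unique {n} {q} {k} {r} {x} r<n x<n eq = q≡k , r≡x
  where
  instance
    n≢0 : NonZero n
    n≢0 = >-nonZero (≤-<-trans z≤n r<n)
  r≡x : r ≡ x
  r≡x = begin
    r                ≡⟨ sym (m<n⇒m%n≡m r<n) ⟩
    r % n            ≡⟨ sym ([m+kn]%n≡m%n r q n) ⟩
    (r + q * n) % n  ≡⟨ %-congˡ (trans (+-comm r (q * n)) (trans eq (+-comm (k * n) x))) ⟩
    (x + k * n) % n  ≡⟨ [m+kn]%n≡m%n x k n ⟩
    x % n            ≡⟨ m<n⇒m%n≡m x<n ⟩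
    x                ∎
  q≡k : q ≡ k
  q≡k = *-cancelʳ-≡ q k n (+-cancelʳ-≡ r (q * n) (k * n) (trans eq (cong (k * n +_) (sym r≡x))))

shuffle-generator : ∀ t f v g → (t * f + v) + (f + g) ≡ (f + t * f) + (g + v)
shuffle-generator = solve-∀

fibSummands : ℕ → List ℕ
fibSummands zero = []
fibSummands (suc zero) = 0 ∷ []
fibSummands (suc (suc k)) = k ∷ []

fibSum-fibSummands : ∀ n → fibSum (fibSummands n) ≡ fib n
fibSum-fibSummands zero = refl
fibSum-fibSummands (suc zero) = refl
fibSum-fibSummands (suc (suc k)) = +-identityʳ (F k)

length-fibSummands : ∀ n → length (fibSummands n) ≤ 1
length-fibSummands zero = z≤n
length-fibSummands (suc zero) = ≤-refl
length-fibSummands (suc (suc k)) = ≤-refl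

InS-decompose : ∀ {a s} → InS a s → Σ[ t ∈ ℕ ] Σ[ M ∈ List ℕ ] s ≡ t * fib a + fibSum M × length M ≤ t
InS-decompose s-zero = 0 , [] , refl , z≤n
InS-decompose {a} (s-add {s} s∈S n) with InS-decompose s∈S
... | t , M , s≡ , M≤t = suc t , fibSummands n ++ M , s+g≡ , M′≤t+1
  where
  s+g≡ : s + (fib a + fib n) ≡ suc t * fib a + fibSum (fibSummands n ++ M)
  s+g≡ = begin
    s + (fib a + fib n)                               ≡⟨ cong (_+ (fib a + fib n)) s≡ ⟩
    (t * fib a + fibSum M) + (fib a + fib n)          ≡⟨ shuffle-generator t (fib a) (fibSum M) (fib n) ⟩
    suc t * fib a + (fib n + fibSum M)                ≡⟨ cong (λ g → suc t * fib a + (g + fibSum M)) (sym (fibSum-fibSummands n)) ⟩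
    suc t * fib a + (fibSum (fibSummands n) + fibSum M) ≡⟨ cong (suc t * fib a +_) (sym (fibSum-++ (fibSummands n) M)) ⟩
    suc t * fib a + fibSum (fibSummands n ++ M)       ∎
  M′≤t+1 : length (fibSummands n ++ M) ≤ suc t
  M′≤t+1 = ≤-trans (≤-reflexive (length-++ (fibSummands n))) (+-mono-≤ (length-fibSummands n) M≤t)

InS-fibSum : ∀ a L → InS a (length L * fib a + fibSum L)
InS-fibSum a [] = s-zero
InS-fibSum a (k ∷ L) =
  subst (InS a) (shuffle-generator (length L) (fib a) (fibSum L) (F k)) (s-add (InS-fibSum a L) (suc (suc k)))

InS-class⇒representation : ∀ a {s k x} → InS (3 + a) s → s ≡ k * F (suc a) + x → x < F (suc a) →
                           Σ[ R ∈ List ℕ ] fibSum R ≡ x × length R ≤ k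
InS-class⇒representation a {s} {k} {x} s∈S s≡ x<F with InS-decompose s∈S
... | t , M , s≡′ , M≤t with reduction-fibSum a M
...   | reduction q R R< M≡ R≤M+q with quotRem-unique R< x<F (trans (sym s≡″) s≡)
  where
  s≡″ : s ≡ (t + q) * F (suc a) + fibSum R
  s≡″ = begin
    s                                          ≡⟨ s≡′ ⟩
    t * F (suc a) + fibSum M                   ≡⟨ cong (t * F (suc a) +_) M≡ ⟩
    t * F (suc a) + (q * F (suc a) + fibSum R) ≡⟨ sym (+-assoc (t * F (suc a)) (q * F (suc a)) (fibSum R)) ⟩
    t * F (suc a) + q * F (suc a) + fibSum R   ≡⟨ cong (_+ fibSum R) (sym (*-distribʳ-+ (F (suc a)) t q)) ⟩
    (t + q) * F (suc a) + fibSum R             ∎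
...     | t+q≡k , R≡x = R , R≡x , subst (length R ≤_) t+q≡k (≤-trans R≤M+q (+-monoˡ-≤ q M≤t))

theorem16 : (a : ℕ) → 3 ≤ a → (x : ℕ) → x < fib a →
    Σ ℕ λ b → IsBeta x b × IsLeastInClass a x (b * fib a + x)
theorem16 (suc (suc (suc a))) (s≤s (s≤s (s≤s _))) x x<F =
  length summands , optimal⇒IsBeta o , member , (length summands , refl) , least
  where
  o = optimal x
  open Optimal o
  member : InS (3 + a) (length summands * F (suc a) + x)
  member = subst (λ v → InS (3 + a) (length summands * F (suc a) + v)) value (InS-fibSum (3 + a) summands)
  least : ∀ s → InS (3 + a) s → CongMod (F (suc a)) s x → length summands * F (suc a) + x ≤ s
  least s s∈S (k , s≡) with InS-class⇒representation a {k = k} s∈S s≡ x<F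
  ... | R , R≡x , R≤k =
    subst (length summands * F (suc a) + x ≤_) (sym s≡)
      (+-monoˡ-≤ x (*-monoˡ-≤ (F (suc a)) (≤-trans (minimal R R≡x) R≤k)))
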